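{- Let $k,s\ge0$ and let $t_1,t_2$ be ordered-data trees over a finite alphabet $\Gamma$ with $\mathcal{V}^{k2^s}_\Gamma(t_1)=\mathcal{V}^{k2^s}_\Gamma(t_2)$. Then for every $\mathrm{MSO}(\sim,\prec,\prec_{suc})$ sentence $\varphi$ with $\mathrm{MSO\text{ - }qr}(\varphi)\le s$ and $\mathrm{FO\text{ - }qr}(\varphi)\le k$, $t_1\models\varphi$ if and only if $t_2\models\varphi$.
   Context: An ordered-data tree over $\Gamma$ is a finite unranked ordered tree whose nodes carry a label in $\Gamma$ and a data value in $\mathbb{N}$; relations: $u\sim v$ iff equal data values, $u\prec v$ iff smaller data value, $u\prec_{suc}v$ iff the data value of $v$ is the least data value in the tree greater than that of $u$, plus label predicates. A $k$-characteristic function for $S\subseteq\Gamma$ is $f:\Gamma\to\{0,\dots,k\}$ with $f(a)\in\{1,\dots,k\}$ for $a\in S$ and $f(a)=0$ for $a\notin S$. Let $V(a)$ be the set of data values of $a$-nodes and $[S]=\bigcap_{a\in S}V(a)\cap\bigcap_{b\notin S}\overline{V(b)}$. If $d_1<\dots<d_m$ are the data values of $t$, the $k$-extended representation $\mathcal{V}^k_\Gamma(t)$ is $(S_1,f_1)\cdots(S_m,f_m)$ where $d_i\in[S_i]$, $f_i$ is a $k$-characteristic function for $S_i$, and for each $a$: if $1\le f_i(a)\le k-1$ there are exactly $f_i(a)$ $a$-nodes with value $d_i$, and if $f_i(a)=k$ there are at least $k$ such nodes. Sentences of $\mathrm{MSO}(\sim,\prec,\prec_{suc})$ (which do not use the tree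 relations) are assumed of the form $Q_1X_1\cdots Q_sX_s\,\psi$ with $\psi$ first-order; $\mathrm{MSO\text{ - }qr}=s$ and $\mathrm{FO\text{ - }qr}$ is the quantifier rank of $\psi$. -}

module Defs where

open import Data.Nat using (ℕ; zero; suc; _+_; _*_; _^_; _≤_; _<_; _⊓_; _≤?_; _⊔_)
open import Data.Nat.Properties using () renaming (_≟_ to _≟ℕ_)
open import Data.Fin using (Fin) renaming (_≟_ to _≟F_)
open import Data.Fin.Subset using (Subset; _∈_)
open import Data.List using (List; []; _∷_; _++_; length; filter; lookup; upTo; map; foldr)
open import Data.List.Membership.DecPropositional _≟ℕ_ using (_∈?_)
open import Data.Vec using (Vec; tabulate)
open import Data.Vec.Functional using (Vector) renaming (_∷_ to _∷ᶠ_)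
open import Data.Product using (_×_; _,_; proj₁; proj₂; Σ)
open import Data.Sum using (_⊎_)
open import Data.Empty using (⊥)
open import Data.Bool using (Bool; _∧_)
open import Relation.Nullary using (¬_; does)
open import Relation.Nullary.Decidable using (_×-dec_)
open import Relation.Binary.PropositionalEquality using (_≡_)

-- Ordered-data trees over the finite alphabet Γ = Fin g:
-- finite unranked ordered trees, each node carrying a label and a datum.

data Tree (g : ℕ) : Set where
  node : Fin g → ℕ → List (Tree g) → Tree g

mutual
  nodes : ∀ {g} → Tree g → List (Fin g × ℕ)
  nodes (node a d ts) = (a , d) ∷ nodesF ts

  nodesF : ∀ {g} → List (Tree g) → List (Fin g × ℕ)
  nodesF []       = []
  nodesF (t ∷ ts) = nodes t ++ nodesF ts

Node : ∀ {g} → Tree g → Set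
Node t = Fin (length (nodes t))

label : ∀ {g} (t : Tree g) → Node t → Fin g
label t u = proj₁ (lookup (nodes t) u)

datum : ∀ {g} (t : Tree g) → Node t → ℕ
datum t u = proj₂ (lookup (nodes t) u)

-- Syntax of MSO(~, ≺, ≺suc) (no tree relations), de Bruijn style.
-- FO g m n : first-order formulas with m free set variables and
-- n free first-order variables.

data FO (g m : ℕ) : ℕ → Set where
  _≐_    : ∀ {n} → Fin n → Fin n → FO g m n
  _∼_    : ∀ {n} → Fin n → Fin n → FO g m n
  _≺_    : ∀ {n} → Fin n → Fin n → FO g m n
  _≺suc_ : ∀ {n} → Fin n → Fin n → FO g m n
  lab    : ∀ {n} → Fin g → Fin n → FO g m n
  _∈ₛ_   : ∀ {n} → Fin n → Fin m → FO g m n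
  ¬ᶠ_    : ∀ {n} → FO g m n → FO g m n
  _∧ᶠ_   : ∀ {n} → FO g m n → FO g m n → FO g m n
  _∨ᶠ_   : ∀ {n} → FO g m n → FO g m n → FO g m n
  ∃ᶠ     : ∀ {n} → FO g m (suc n) → FO g m n
  ∀ᶠ     : ∀ {n} → FO g m (suc n) → FO g m n

qr : ∀ {g m n} → FO g m n → ℕ
qr (x ≐ y)     = 0
qr (x ∼ y)     = 0
qr (x ≺ y)     = 0
qr (x ≺suc y)  = 0
qr (lab a x)   = 0
qr (x ∈ₛ X)    = 0
qr (¬ᶠ φ)      = qr φ
qr (φ ∧ᶠ ψ)    = qr φ ⊔ qr ψ
qr (φ ∨ᶠ ψ)    = qr φ ⊔ qr ψ
qr (∃ᶠ φ)      = suc (qr φ)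
qr (∀ᶠ φ)      = suc (qr φ)

data MSO (g : ℕ) : ℕ → Set where
  fo : ∀ {m} → FO g m 0 → MSO g m
  ∃ˢ : ∀ {m} → MSO g (suc m) → MSO g m
  ∀ˢ : ∀ {m} → MSO g (suc m) → MSO g m

Sentence : ℕ → Set
Sentence g = MSO g 0

msoQr : ∀ {g m} → MSO g m → ℕ
msoQr (fo ψ) = 0
msoQr (∃ˢ φ) = suc (msoQr φ)
msoQr (∀ˢ φ) = suc (msoQr φ)

foQr : ∀ {g m} → MSO g m → ℕ
foQr (fo ψ) = qr ψ
foQr (∃ˢ φ) = foQr φ
foQr (∀ˢ φ) = foQr φ

SuccData : ∀ {g} (t : Tree g) → Node t → Node t → Set
SuccData t u v =
  datum t u < datum t v × (∀ w → datum t u < datum t w → datum t v ≤ datum t w)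

Sat : ∀ {g m n} (t : Tree g) →
      Vector (Subset (length (nodes t))) m → Vector (Node t) n → FO g m n → Set
Sat t ρ σ (x ≐ y)    = σ x ≡ σ y
Sat t ρ σ (x ∼ y)    = datum t (σ x) ≡ datum t (σ y)
Sat t ρ σ (x ≺ y)    = datum t (σ x) < datum t (σ y)
Sat t ρ σ (x ≺suc y) = SuccData t (σ x) (σ y)
Sat t ρ σ (lab a x)  = label t (σ x) ≡ a
Sat t ρ σ (x ∈ₛ X)   = σ x ∈ ρ X
Sat t ρ σ (¬ᶠ φ)     = ¬ Sat t ρ σ φ
Sat t ρ σ (φ ∧ᶠ ψ)   = Sat t ρ σ φ × Sat t ρ σ ψ
Sat t ρ σ (φ ∨ᶠ ψ)   = Sat t ρ σ φ ⊎ Sat t ρ σ ψ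
Sat t ρ σ (∃ᶠ φ)     = Σ (Node t) λ u → Sat t ρ (u ∷ᶠ σ) φ
Sat t ρ σ (∀ᶠ φ)     = (u : Node t) → Sat t ρ (u ∷ᶠ σ) φ

SatM : ∀ {g m} (t : Tree g) → Vector (Subset (length (nodes t))) m → MSO g m → Set
SatM t ρ (fo ψ) = Sat t ρ (λ ()) ψ
SatM t ρ (∃ˢ φ) = Σ (Subset (length (nodes t))) λ X → SatM t (X ∷ᶠ ρ) φ
SatM t ρ (∀ˢ φ) = (X : Subset (length (nodes t))) → SatM t (X ∷ᶠ ρ) φ

_⊨_ : ∀ {g} → Tree g → Sentence g → Set
t ⊨ φ = SatM t (λ ()) φ

dataValues : ∀ {g} → Tree g → List ℕ
dataValues t = map proj₂ (nodes t)

-- the distinct data values d₁ < ⋯ < d_m of t, in increasing order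
sortedData : ∀ {g} → Tree g → List ℕ
sortedData t =
  filter (λ d → d ∈? dataValues t) (upTo (suc (foldr _⊔_ 0 (dataValues t))))

count : ∀ {g} → Tree g → Fin g → ℕ → ℕ
count t a d = length (filter (λ p → (proj₁ p ≟F a) ×-dec (proj₂ p ≟ℕ d)) (nodes t))

-- S: the set of labels a with d ∈ V(a)  (so that d ∈ [S])
labelSet : ∀ {g} → Tree g → ℕ → Subset g
labelSet t d = tabulate (λ a → does (1 ≤? count t a d))

charFun : ∀ {g} → ℕ → Tree g → ℕ → Vec ℕ g
charFun K t d = tabulate (λ a → count t a d ⊓ K)

extRep : ∀ {g} → ℕ → Tree g → List (Subset g × Vec ℕ g)
extRep K t = map (λ d → labelSet t d , charFun K t d) (sortedData t)

module Submission where

-- Summarise a node by its key: the rank i of its data value among d₁ < ⋯ < d_m, its label,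
-- and its membership in the interpreted set variables.  If in two trees every key class has
-- the same size up to a threshold r (counting only unpebbled nodes), the second player wins the
-- r-round Ehrenfeucht–Fraïssé game: a pebbled node is answered by its partner and a fresh node
-- by a fresh node with the same key, which lowers the threshold by one.  Ranks, unlike data
-- values, are carried by keys and still determine ∼, ≺ and ≺suc.  For a set quantifier,
-- splitting each class by the chosen set X, class sizes that agree up to 2h can be split on the
-- other side so that both halves agree up to h; so s set quantifiers consume a factor 2^s.
-- Equal k·2^s-extended representations say exactly that the (rank, label) classes agree up to
-- k·2^s.

open import Data.Bool using (Bool; true; false; _∧_; _∨_; not; if_then_else_)
import Data.Bool.Properties as Bool
open import Data.Empty using (⊥-elim)
open import Data.Fin using (Fin; toℕ) renaming (zero to fzero; suc to fsuc)
import Data.Fin.Properties as Fin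
open import Data.Fin.Subset using (Subset) renaming (_∈_ to _∈ˢ_)
open import Data.List as List using (List; []; _∷_; length; filter)
open import Data.List.Membership.Propositional using (_∈_)
open import Data.List.Membership.Propositional.Properties
  using (∈-filter⁺; ∈-filter⁻; ∈-upTo⁺; ∈-map⁺; ∈-map⁻; ∈-lookup)
import Data.List.Relation.Unary.All as All
open import Data.List.Relation.Unary.AllPairs using (AllPairs; []; _∷_)
import Data.List.Relation.Unary.AllPairs.Properties as AllPairs
open import Data.List.Relation.Unary.Any as Any using (here; there)
open import Data.List.Relation.Unary.Any.Properties using (lookup-index)
open import Data.Maybe as Maybe using (Maybe; just; nothing)
open import Data.Maybe.Properties using (just-injective)
open import Data.Nat using (ℕ; zero; suc; _+_; _*_; _^_; _∸_; _≤_; _<_; _⊓_; _⊔_; z≤n; s≤s)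
open import Data.Nat.Properties
open import Data.List.Membership.DecPropositional _≟_ using (_∈?_)
open import Data.Product using (_×_; _,_; proj₁; proj₂; Σ; ∃; ∃₂; map; map₂)
open import Data.Product.Function.NonDependent.Propositional using (_×-⇔_)
import Data.Product.Properties as ×
open import Data.Sum using (inj₁; inj₂)
open import Data.Sum.Function.Propositional using (_⊎-⇔_)
open import Data.Vec as Vec using (Vec; []; _∷_)
open import Data.Vec.Functional using (Vector) renaming (_∷_ to _∷ᶠ_)
open import Data.Vec.Properties as Vec using ([]=⇒lookup; lookup⇒[]=)
open import Function.Base using (_∘_; id; case_of_)
open import Function.Bundles using (_⇔_; mk⇔; Equivalence)
import Function.Properties.Equivalence as ⇔
open import Function.Related.TypeIsomorphisms using (→-cong-⇔)
open import Relation.Binary.Definitions using (tri<; tri≈; tri>; DecidableEquality)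
open import Relation.Binary.PropositionalEquality
open import Relation.Nullary using (¬_; yes; no; does; Dec)
open import Relation.Nullary.Decidable using (does-⇔; dec-true; dec-false; _×-dec_; ¬?)

open import Defs

-- Equality up to a threshold

infix 4 _≡[_]_

_≡[_]_ : ℕ → ℕ → ℕ → Set
a ≡[ r ] b = a ⊓ r ≡ b ⊓ r

≡[]-weaken : ∀ {a b r s} → r ≤ s → a ≡[ s ] b → a ≡[ r ] b
≡[]-weaken {a} {b} {r} {s} r≤s a≡b = begin
  a ⊓ r         ≡⟨ cong (a ⊓_) (sym (m≥n⇒m⊓n≡n r≤s)) ⟩
  a ⊓ (s ⊓ r)   ≡⟨ sym (⊓-assoc a s r) ⟩
  (a ⊓ s) ⊓ r   ≡⟨ cong (_⊓ r) a≡b ⟩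
  (b ⊓ s) ⊓ r   ≡⟨ ⊓-assoc b s r ⟩
  b ⊓ (s ⊓ r)   ≡⟨ cong (b ⊓_) (m≥n⇒m⊓n≡n r≤s) ⟩
  b ⊓ r         ∎
  where open ≡-Reasoning

≡[]-positive : ∀ {a b r} → a ≡[ suc r ] b → 0 < a → 0 < b
≡[]-positive {suc a} {zero} ()
≡[]-positive {b = suc b} _ _ = s≤s z≤n

≡[]-below : ∀ {a b r} → a ≡[ r ] b → a < r → a ≡ b
≡[]-below {a} {b} {r} a≡b a<r = trans a≡a⊓r (trans a≡b (m≤n⇒m⊓n≡m b≤r))
  where
    a≡a⊓r : a ≡ a ⊓ r
    a≡a⊓r = sym (m≤n⇒m⊓n≡m (<⇒≤ a<r))
    b≤r : b ≤ r
    b≤r = ≮⇒≥ λ r<b → <⇒≢ a<r (trans a≡a⊓r (trans a≡b (m≥n⇒m⊓n≡n (<⇒≤ r<b))))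

≡[]-above : ∀ {a b r} → r ≤ a → r ≤ b → a ≡[ r ] b
≡[]-above r≤a r≤b = trans (m≥n⇒m⊓n≡n r≤a) (sym (m≥n⇒m⊓n≡n r≤b))

h≤[h+h]∸ : ∀ {h c e} → h + h ≤ c → e ≤ h → h ≤ c ∸ e
h≤[h+h]∸ {h} {c} {e} 2h≤c e≤h = subst (_≤ c ∸ e) (m+n∸n≡m h h) (∸-mono 2h≤c e≤h)

≡[]-split-above : ∀ {x z c h} → h + h ≤ x + z → h + h ≤ c →
                  ∃₂ λ y z′ → y + z′ ≡ c × x ≡[ h ] y × z ≡[ h ] z′
≡[]-split-above {x} {z} {c} {h} 2h≤x+z 2h≤c with x ≤? h
... | yes x≤h = x , c ∸ x , m+[n∸m]≡n (≤-trans x≤h h≤c) , refl ,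
                ≡[]-above h≤z (h≤[h+h]∸ 2h≤c x≤h)
  where
    h≤c : h ≤ c
    h≤c = ≤-trans (m≤m+n h h) 2h≤c
    h≤z : h ≤ z
    h≤z = +-cancelˡ-≤ x h z (≤-trans (+-monoˡ-≤ h x≤h) 2h≤x+z)
... | no x≰h = c ∸ z ⊓ h , z ⊓ h , m∸n+n≡m (≤-trans (m⊓n≤n z h) (≤-trans (m≤m+n h h) 2h≤c)) ,
               ≡[]-above (<⇒≤ (≰⇒> x≰h)) (h≤[h+h]∸ 2h≤c (m⊓n≤n z h)) ,
               sym (m≤n⇒m⊓n≡m (m⊓n≤n z h))

≡[]-split : ∀ {x z c h} → x + z ≡[ h + h ] c →
            ∃₂ λ y z′ → y + z′ ≡ c × x ≡[ h ] y × z ≡[ h ] z′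
≡[]-split {x} {z} {c} {h} x+z≡c with x + z <? h + h
... | yes small = x , z , ≡[]-below x+z≡c small , refl , refl
... | no large = ≡[]-split-above 2h≤x+z
                   (subst (_≤ c) (trans (sym x+z≡c) (m≥n⇒m⊓n≡n 2h≤x+z)) (m⊓n≤m c (h + h)))
  where
    2h≤x+z : h + h ≤ x + z
    2h≤x+z = ≮⇒≥ large

indicator : Bool → ℕ
indicator true  = 1
indicator false = 0

≡[]-cancel : ∀ b {a a′ r} → indicator b + a ≡[ suc r ] indicator b + a′ → a ≡[ r ] a′
≡[]-cancel true  a≡a′ = suc-injective a≡a′
≡[]-cancel false a≡a′ = ≡[]-weaken (n≤1+n _) a≡a′

-- Counting

card : ∀ {N} → (Fin N → Bool) → ℕ
card {zero}  f = 0
card {suc N} f = indicator (f fzero) + card (f ∘ fsuc)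

card-cong : ∀ {N} {f h : Fin N → Bool} → (∀ u → f u ≡ h u) → card f ≡ card h
card-cong {zero}  f≡h = refl
card-cong {suc N} f≡h = cong₂ (λ b n → indicator b + n) (f≡h fzero) (card-cong (f≡h ∘ fsuc))

card-empty : ∀ {N} {f : Fin N → Bool} → (∀ u → f u ≡ false) → card f ≡ 0
card-empty {zero}  f≡false = refl
card-empty {suc N} f≡false rewrite f≡false fzero = card-empty (f≡false ∘ fsuc)

card-witness : ∀ {N} {P : Fin N → Set} (P? : ∀ u → Dec (P u)) → 0 < card (λ u → does (P? u)) → ∃ P
card-witness {suc N} P? 0<card with P? fzero
... | yes p = fzero , p
... | no _  = map fsuc id (card-witness (P? ∘ fsuc) 0<card)

card-positive : ∀ {N} (f : Fin N → Bool) u → f u ≡ true → 0 < card f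
card-positive f fzero    fu≡true rewrite fu≡true = s≤s z≤n
card-positive f (fsuc u) fu≡true with f fzero
... | true  = s≤s z≤n
... | false = card-positive (f ∘ fsuc) u fu≡true

card-split : ∀ {N} (f h : Fin N → Bool) →
             card f ≡ card (λ u → f u ∧ h u) + card (λ u → f u ∧ not (h u))
card-split {zero}  f h = refl
card-split {suc N} f h with f fzero | h fzero
... | false | _     = card-split (f ∘ fsuc) (h ∘ fsuc)
... | true  | true  = cong suc (card-split (f ∘ fsuc) (h ∘ fsuc))
... | true  | false = trans (cong suc (card-split (f ∘ fsuc) (h ∘ fsuc))) (sym (+-suc _ _))

card-remove : ∀ {N} (f : Fin N → Bool) u →
              card f ≡ indicator (f u) + card (λ w → f w ∧ not (does (u Fin.≟ w)))
card-remove {suc N} f fzero with f fzero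
... | true  = cong suc (card-cong (λ w → sym (Bool.∧-identityʳ (f (fsuc w)))))
... | false = card-cong (λ w → sym (Bool.∧-identityʳ (f (fsuc w))))
card-remove {suc N} f (fsuc u) with f fzero
... | false = card-remove (f ∘ fsuc) u
... | true  = trans (cong suc (card-remove (f ∘ fsuc) u)) (sym (+-suc _ _))

card-select : ∀ {N} (f : Fin N → Bool) {y} → y ≤ card f →
              ∃ λ (h : Fin N → Bool) → card (λ u → f u ∧ h u) ≡ y
card-select {zero}  f z≤n = (λ _ → false) , refl
card-select {suc N} f = select-head (f fzero)
  where
    select-head : ∀ b {y} → y ≤ indicator b + card (f ∘ fsuc) →
                  ∃ λ (h : Fin (suc N) → Bool) →
                    indicator (b ∧ h fzero) + card (λ u → f (fsuc u) ∧ h (fsuc u)) ≡ y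
    select-head false y≤card with card-select (f ∘ fsuc) y≤card
    ... | h , card≡y = (false ∷ᶠ h) , card≡y
    select-head true {zero} _ = (λ _ → false) , card-empty (λ u → Bool.∧-zeroʳ (f (fsuc u)))
    select-head true {suc y} (s≤s y≤card) with card-select (f ∘ fsuc) y≤card
    ... | h , card≡y = (true ∷ᶠ h) , cong suc card≡y

card-filter : ∀ {A : Set} {P : A → Set} (P? : ∀ x → Dec (P x)) (xs : List A) →
              length (filter P? xs) ≡ card (λ i → does (P? (List.lookup xs i)))
card-filter P? []       = refl
card-filter P? (x ∷ xs) with does (P? x)
... | true  = cong suc (card-filter P? xs)
... | false = card-filter P? xs

cardOn : ∀ {N} → (Fin N → Bool) → Subset N → Bool → ℕ
cardOn f X b = card (λ u → f u ∧ (if b then Vec.lookup X u else not (Vec.lookup X u)))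

select-in-classes : ∀ {N} {C : Set} (_≟_ : DecidableEquality C) (κ : Fin N → C) (target : C → Bool → ℕ) →
                    (∀ c → target c true + target c false ≡ card (λ u → does (κ u ≟ c))) →
                    ∃ λ (Y : Subset N) → ∀ c b → cardOn (λ u → does (κ u ≟ c)) Y b ≡ target c b
select-in-classes {N} _≟_ κ target sum = Y , sizes
  where
    class : _ → Fin N → Bool
    class c u = does (κ u ≟ c)
    selection : ∀ c → ∃ λ h → card (λ u → class c u ∧ h u) ≡ target c true
    selection c = card-select (class c) (subst (target c true ≤_) (sum c) (m≤m+n _ _))
    chosen : Fin N → Bool
    chosen u = proj₁ (selection (κ u)) u
    Y = Vec.tabulate chosen
    restrict : ∀ c u → class c u ∧ chosen u ≡ class c u ∧ proj₁ (selection c) u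
    restrict c u with κ u ≟ c
    ... | yes refl = refl
    ... | no _     = refl
    inside : ∀ c → cardOn (class c) Y true ≡ target c true
    inside c = trans (card-cong λ u → trans (cong (class c u ∧_) (Vec.lookup∘tabulate chosen u)) (restrict c u))
                     (proj₂ (selection c))
    sizes : ∀ c b → cardOn (class c) Y b ≡ target c b
    sizes c true  = inside c
    sizes c false = +-cancelˡ-≡ (target c true) _ _ (begin
      target c true + cardOn (class c) Y false            ≡⟨ cong (_+ cardOn (class c) Y false) (sym (inside c)) ⟩
      cardOn (class c) Y true + cardOn (class c) Y false  ≡⟨ sym (card-split (class c) (Vec.lookup Y)) ⟩
      card (class c)                                      ≡⟨ sym (sum c) ⟩
      target c true + target c false                      ∎)
      where open ≡-Reasoning

-- Ranks of data values

infixl 5 _‼_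

_‼_ : ∀ {A : Set} → List A → ℕ → Maybe A
[]       ‼ i     = nothing
(x ∷ xs) ‼ zero  = just x
(x ∷ xs) ‼ suc i = xs ‼ i

‼-index : ∀ {A : Set} {x : A} {xs} (x∈xs : x ∈ xs) → xs ‼ toℕ (Any.index x∈xs) ≡ just x
‼-index (here refl) = refl
‼-index (there x∈xs) = ‼-index x∈xs

‼-∈ : ∀ {A : Set} {x : A} xs i → xs ‼ i ≡ just x → x ∈ xs
‼-∈ (y ∷ xs) zero    refl  = here refl
‼-∈ (y ∷ xs) (suc i) xs‼i = there (‼-∈ xs i xs‼i)

‼-map : ∀ {A B : Set} (f : A → B) xs i → List.map f xs ‼ i ≡ Maybe.map f (xs ‼ i)
‼-map f []       i       = refl
‼-map f (x ∷ xs) zero    = refl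
‼-map f (x ∷ xs) (suc i) = ‼-map f xs i

‼-defined : ∀ {A : Set} {y : A} xs {i j} → xs ‼ j ≡ just y → i < j → ∃ λ x → xs ‼ i ≡ just x
‼-defined (x ∷ xs) {zero}  {suc j} _    _         = x , refl
‼-defined (x ∷ xs) {suc i} {suc j} xs‼j (s≤s i<j) = ‼-defined xs xs‼j i<j

module Increasing {xs : List ℕ} (increasing : AllPairs _<_ xs) where

  ‼-<-mono : ∀ {i j a b} → xs ‼ i ≡ just a → xs ‼ j ≡ just b → i < j → a < b
  ‼-<-mono = go increasing
    where
      go : ∀ {ys} → AllPairs _<_ ys → ∀ {i j a b} → ys ‼ i ≡ just a → ys ‼ j ≡ just b → i < j → a < b
      go {y ∷ ys} (y< ∷ _) {zero}  {suc j} refl ys‼j _         = All.lookup y< (‼-∈ ys j ys‼j)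
      go {y ∷ ys} (_ ∷ inc) {suc i} {suc j} ys‼i ys‼j (s≤s i<j) = go inc ys‼i ys‼j i<j

  module _ {i j a b} (xs‼i : xs ‼ i ≡ just a) (xs‼j : xs ‼ j ≡ just b) where

    ‼-≡-⇔ : i ≡ j ⇔ a ≡ b
    ‼-≡-⇔ = mk⇔ to from
      where
        to : i ≡ j → a ≡ b
        to refl = just-injective (trans (sym xs‼i) xs‼j)
        from : a ≡ b → i ≡ j
        from refl with <-cmp i j
        ... | tri< i<j _ _ = ⊥-elim (<-irrefl refl (‼-<-mono xs‼i xs‼j i<j))
        ... | tri≈ _ i≡j _ = i≡j
        ... | tri> _ _ j<i = ⊥-elim (<-irrefl refl (‼-<-mono xs‼j xs‼i j<i))

    ‼-<-⇔ : i < j ⇔ a < b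
    ‼-<-⇔ = mk⇔ (‼-<-mono xs‼i xs‼j) from
      where
        from : a < b → i < j
        from a<b with <-cmp i j
        ... | tri< i<j _ _ = i<j
        ... | tri≈ _ refl _ = ⊥-elim (<-irrefl (Equivalence.to ‼-≡-⇔ refl) a<b)
        ... | tri> _ _ j<i = ⊥-elim (<-asym a<b (‼-<-mono xs‼j xs‼i j<i))

∈⇒≤foldr-⊔ : ∀ {d xs} → d ∈ xs → d ≤ List.foldr _⊔_ 0 xs
∈⇒≤foldr-⊔ {xs = x ∷ xs} (here refl) = m≤m⊔n x _
∈⇒≤foldr-⊔ {xs = x ∷ xs} (there d∈xs) = ≤-trans (∈⇒≤foldr-⊔ d∈xs) (m≤n⊔m x _)

module _ {g} (t : Tree g) where

  private
    D = sortedData t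
    occurs? = λ d → d ∈? dataValues t

  sortedData-increasing : AllPairs _<_ D
  sortedData-increasing = AllPairs.filter⁺ occurs? (AllPairs.applyUpTo⁺₁ id _ (λ i<j _ → i<j))

  datum∈sortedData : ∀ u → datum t u ∈ D
  datum∈sortedData u = ∈-filter⁺ occurs? (∈-upTo⁺ (s≤s (∈⇒≤foldr-⊔ datum∈data))) datum∈data
    where
      datum∈data : datum t u ∈ dataValues t
      datum∈data = ∈-map⁺ proj₂ (∈-lookup u)

  sortedData-datum : ∀ {d} → d ∈ D → ∃ λ u → datum t u ≡ d
  sortedData-datum d∈D with ∈-map⁻ proj₂ (proj₂ (∈-filter⁻ occurs? {xs = List.upTo _} d∈D))
  ... | _ , p∈nodes , refl = Any.index p∈nodes , cong proj₂ (sym (lookup-index p∈nodes))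

  -- The index i with datum t u = dᵢ, i.e. the position of its entry (Sᵢ, fᵢ) in extRep.
  rank : Node t → ℕ
  rank u = toℕ (Any.index (datum∈sortedData u))

  sortedData-‼-rank : ∀ u → D ‼ rank u ≡ just (datum t u)
  sortedData-‼-rank u = ‼-index (datum∈sortedData u)

  private
    open Increasing sortedData-increasing

    ‼-rank-⇔ : ∀ {R S : ℕ → ℕ → Set} →
               (∀ {i j a b} → D ‼ i ≡ just a → D ‼ j ≡ just b → R i j ⇔ S a b) →
               ∀ u v → S (datum t u) (datum t v) ⇔ R (rank u) (rank v)
    ‼-rank-⇔ R⇔S u v = ⇔.sym (R⇔S (sortedData-‼-rank u) (sortedData-‼-rank v))

  ≡⇔rank≡ : ∀ u v → datum t u ≡ datum t v ⇔ rank u ≡ rank v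
  ≡⇔rank≡ = ‼-rank-⇔ ‼-≡-⇔

  <⇔rank< : ∀ u v → datum t u < datum t v ⇔ rank u < rank v
  <⇔rank< = ‼-rank-⇔ ‼-<-⇔

  SuccData⇔rank-suc : ∀ u v → SuccData t u v ⇔ suc (rank u) ≡ rank v
  SuccData⇔rank-suc u v = mk⇔ to from
    where
      from : suc (rank u) ≡ rank v → SuccData t u v
      from 1+ru≡rv = Equivalence.from (<⇔rank< u v) (≤-reflexive 1+ru≡rv) , least
        where
          least : ∀ w → datum t u < datum t w → datum t v ≤ datum t w
          least w du<dw = ≮⇒≥ λ dw<dv → <⇒≱ (Equivalence.to (<⇔rank< w v) dw<dv)
                            (subst (_≤ rank w) 1+ru≡rv (Equivalence.to (<⇔rank< u w) du<dw))
      to : SuccData t u v → suc (rank u) ≡ rank v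
      to (du<dv , least) with m≤n⇒m<n∨m≡n (Equivalence.to (<⇔rank< u v) du<dv)
      ... | inj₂ 1+ru≡rv = 1+ru≡rv
      ... | inj₁ 1+ru<rv with ‼-defined D (sortedData-‼-rank v) 1+ru<rv
      ...   | d , D‼1+ru with sortedData-datum (‼-∈ D _ D‼1+ru)
      ...     | w , refl = ⊥-elim (<⇒≱ (‼-<-mono D‼1+ru (sortedData-‼-rank v) 1+ru<rv)
                                       (least w (‼-<-mono (sortedData-‼-rank u) D‼1+ru ≤-refl)))

-- Key classes and the first-order game

Assignment : ∀ {g} → Tree g → ℕ → Set
Assignment t m = Vector (Subset (length (nodes t))) m

Key : ℕ → ℕ → Set
Key g m = ℕ × Fin g × Vec Bool m

_≟ᴷ_ : ∀ {g m} → DecidableEquality (Key g m)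
_≟ᴷ_ = ×.≡-dec _≟_ (×.≡-dec Fin._≟_ (Vec.≡-dec Bool._≟_))

colour : ∀ {g m} (t : Tree g) → Assignment t m → Node t → Vec Bool m
colour t ρ u = Vec.tabulate (λ X → Vec.lookup (ρ X) u)

key : ∀ {g m} (t : Tree g) → Assignment t m → Node t → Key g m
key t ρ u = rank t u , label t u , colour t ρ u

inClass : ∀ {g m} (t : Tree g) → Assignment t m → Key g m → Node t → Bool
inClass t ρ c u = does (key t ρ u ≟ᴷ c)

classSize : ∀ {g m} (t : Tree g) → Assignment t m → Key g m → ℕ
classSize t ρ c = card (inClass t ρ c)

∈⇔colour : ∀ {g m} (t : Tree g) (ρ : Assignment t m) u X →
           u ∈ˢ ρ X ⇔ Vec.lookup (colour t ρ u) X ≡ true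
∈⇔colour t ρ u X = mk⇔ (λ u∈X → trans lookup-colour ([]=⇒lookup u∈X))
                       (λ lookup≡ → lookup⇒[]= u (ρ X) (trans (sym lookup-colour) lookup≡))
  where
    lookup-colour : Vec.lookup (colour t ρ u) X ≡ Vec.lookup (ρ X) u
    lookup-colour = Vec.lookup∘tabulate (λ Z → Vec.lookup (ρ Z) u) X

record Pointed (g m n : ℕ) : Set where
  constructor pointed
  field
    tree    : Tree g
    sets    : Assignment tree m
    pebbles : Vector (Node tree) n

  keyOf : Node tree → Key g m
  keyOf = key tree sets

  pebbled? : ∀ u → Dec (∃ λ x → pebbles x ≡ u)
  pebbled? u = Fin.any? (λ x → pebbles x Fin.≟ u)

  freeIn? : ∀ c u → Dec (keyOf u ≡ c × ¬ ∃ λ x → pebbles x ≡ u)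
  freeIn? c u = (keyOf u ≟ᴷ c) ×-dec ¬? (pebbled? u)

  freeSize : Key g m → ℕ
  freeSize c = card (λ u → does (freeIn? c u))

open Pointed

_⊨ᶠ_ : ∀ {g m n} → Pointed g m n → FO g m n → Set
P ⊨ᶠ φ = Sat (tree P) (sets P) (pebbles P) φ

_▷_ : ∀ {g m n} (P : Pointed g m n) → Node (tree P) → Pointed g m (suc n)
P ▷ u = pointed (tree P) (sets P) (u ∷ᶠ pebbles P)

record _≈[_]_ {g m n} (P : Pointed g m n) (r : ℕ) (Q : Pointed g m n) : Set where
  field
    same-equalities : ∀ x y → pebbles P x ≡ pebbles P y ⇔ pebbles Q x ≡ pebbles Q y
    same-keys       : ∀ x → keyOf P (pebbles P x) ≡ keyOf Q (pebbles Q x)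
    same-freeSizes  : ∀ c → freeSize P c ≡[ r ] freeSize Q c

open _≈[_]_

≈-sym : ∀ {g m n r} {P Q : Pointed g m n} → P ≈[ r ] Q → Q ≈[ r ] P
≈-sym P≈Q = record
  { same-equalities = λ x y → ⇔.sym (same-equalities P≈Q x y)
  ; same-keys       = λ x → sym (same-keys P≈Q x)
  ; same-freeSizes  = λ c → sym (same-freeSizes P≈Q c)
  }

record Matches {g m n} (P : Pointed g m n) (u : Node (tree P))
                       (Q : Pointed g m n) (v : Node (tree Q)) : Set where
  field
    same-key     : keyOf P u ≡ keyOf Q v
    same-pebbles : ∀ x → pebbles P x ≡ u ⇔ pebbles Q x ≡ v

open Matches

module _ {g m n} {P Q : Pointed g m n} {u v} (u∼v : Matches P u Q v) where

  matches-freeIn : ∀ c → does (freeIn? P c u) ≡ does (freeIn? Q c v)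
  matches-freeIn c = does-⇔ (same-class ×-⇔ →-cong-⇔ same-pebbled ⇔.refl) (freeIn? P c u) (freeIn? Q c v)
    where
      same-class : keyOf P u ≡ c ⇔ keyOf Q v ≡ c
      same-class = mk⇔ (trans (sym (same-key u∼v))) (trans (same-key u∼v))
      same-pebbled : (∃ λ x → pebbles P x ≡ u) ⇔ (∃ λ x → pebbles Q x ≡ v)
      same-pebbled = mk⇔ (map₂ (Equivalence.to (same-pebbles u∼v _)))
                         (map₂ (Equivalence.from (same-pebbles u∼v _)))

∧-not-∨ : ∀ a e p → a ∧ not (e ∨ p) ≡ (a ∧ not p) ∧ not e
∧-not-∨ false e     p = refl
∧-not-∨ true  true  p = sym (Bool.∧-zeroʳ (not p))
∧-not-∨ true  false p = sym (Bool.∧-identityʳ (not p))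

freeSize-▷ : ∀ {g m n} (P : Pointed g m n) u c →
             freeSize P c ≡ indicator (does (freeIn? P c u)) + freeSize (P ▷ u) c
freeSize-▷ P u c = trans (card-remove _ u) (cong (indicator (does (freeIn? P c u)) +_) (card-cong λ w →
  sym (∧-not-∨ (does (keyOf P w ≟ᴷ c)) (does (u Fin.≟ w)) (does (pebbled? P w)))))

≈-▷ : ∀ {g m n r} {P Q : Pointed g m n} {u v} →
      P ≈[ suc r ] Q → Matches P u Q v → (P ▷ u) ≈[ r ] (Q ▷ v)
≈-▷ {r = r} {P} {Q} {u} {v} P≈Q u∼v = record
  { same-equalities = equalities
  ; same-keys       = λ { fzero → same-key u∼v ; (fsuc x) → same-keys P≈Q x }
  ; same-freeSizes  = λ c → ≡[]-cancel (does (freeIn? Q c v)) (free-sizes c)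
  }
  where
    equalities : ∀ x y → (u ∷ᶠ pebbles P) x ≡ (u ∷ᶠ pebbles P) y ⇔
                         (v ∷ᶠ pebbles Q) x ≡ (v ∷ᶠ pebbles Q) y
    equalities fzero    fzero    = mk⇔ (λ _ → refl) (λ _ → refl)
    equalities fzero    (fsuc y) = ⇔.trans (mk⇔ sym sym) (⇔.trans (same-pebbles u∼v y) (mk⇔ sym sym))
    equalities (fsuc x) fzero    = same-pebbles u∼v x
    equalities (fsuc x) (fsuc y) = same-equalities P≈Q x y
    free-sizes : ∀ c → indicator (does (freeIn? Q c v)) + freeSize (P ▷ u) c
                         ≡[ suc r ] indicator (does (freeIn? Q c v)) + freeSize (Q ▷ v) c
    free-sizes c = begin
      (indicator (does (freeIn? Q c v)) + freeSize (P ▷ u) c) ⊓ suc r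
        ≡⟨ cong (λ b → (indicator b + freeSize (P ▷ u) c) ⊓ suc r) (sym (matches-freeIn u∼v c)) ⟩
      (indicator (does (freeIn? P c u)) + freeSize (P ▷ u) c) ⊓ suc r
        ≡⟨ cong (_⊓ suc r) (sym (freeSize-▷ P u c)) ⟩
      freeSize P c ⊓ suc r
        ≡⟨ same-freeSizes P≈Q c ⟩
      freeSize Q c ⊓ suc r
        ≡⟨ cong (_⊓ suc r) (freeSize-▷ Q v c) ⟩
      (indicator (does (freeIn? Q c v)) + freeSize (Q ▷ v) c) ⊓ suc r ∎
      where open ≡-Reasoning

answer : ∀ {g m n r} {P Q : Pointed g m n} → P ≈[ suc r ] Q → ∀ u → ∃ λ v → Matches P u Q v
answer {P = P} {Q} P≈Q u with pebbled? P u
... | yes (x , refl) = pebbles Q x , record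
  { same-key     = same-keys P≈Q x
  ; same-pebbles = λ y → same-equalities P≈Q y x
  }
... | no unpebbled
  with card-witness (freeIn? Q (keyOf P u))
         (≡[]-positive (same-freeSizes P≈Q _) (card-positive _ u (dec-true (freeIn? P _ u) (refl , unpebbled))))
...   | v , key-v , v-unpebbled = v , record
  { same-key     = sym key-v
  ; same-pebbles = λ x → mk⇔ (λ σx≡u → ⊥-elim (unpebbled (x , σx≡u)))
                             (λ τx≡v → ⊥-elim (v-unpebbled (x , τx≡v)))
  }

forth : ∀ {g m n r} {P Q : Pointed g m n} → P ≈[ suc r ] Q → ∀ u → ∃ λ v → (P ▷ u) ≈[ r ] (Q ▷ v)
forth P≈Q u = map₂ (≈-▷ P≈Q) (answer P≈Q u)

back : ∀ {g m n r} {P Q : Pointed g m n} → P ≈[ suc r ] Q → ∀ v → ∃ λ u → (P ▷ u) ≈[ r ] (Q ▷ v)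
back P≈Q v = map₂ ≈-sym (forth (≈-sym P≈Q) v)

module _ {U V : Set} {A : U → Set} {B : V → Set}
         (forth′ : ∀ u → ∃ λ v → A u ⇔ B v) (back′ : ∀ v → ∃ λ u → A u ⇔ B v) where

  Σ-⇔-back-and-forth : Σ U A ⇔ Σ V B
  Σ-⇔-back-and-forth = mk⇔
    (λ (u , a) → let v , A⇔B = forth′ u in v , Equivalence.to A⇔B a)
    (λ (v , b) → let u , A⇔B = back′ v in u , Equivalence.from A⇔B b)

  Π-⇔-back-and-forth : (∀ u → A u) ⇔ (∀ v → B v)
  Π-⇔-back-and-forth = mk⇔
    (λ a v → let u , A⇔B = back′ v in Equivalence.to A⇔B (a u))
    (λ b u → let v , A⇔B = forth′ u in Equivalence.from A⇔B (b v))

via-ranks : ∀ {g m n r} (R : (t : Tree g) → Node t → Node t → Set) (S : ℕ → ℕ → Set) →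
            (∀ t u v → R t u v ⇔ S (rank t u) (rank t v)) →
            ∀ {P Q : Pointed g m n} → P ≈[ r ] Q → ∀ x y →
            R (tree P) (pebbles P x) (pebbles P y) ⇔ R (tree Q) (pebbles Q x) (pebbles Q y)
via-ranks R S R⇔S {P} {Q} P≈Q x y =
  ⇔.trans (R⇔S _ _ _) (subst₂ (λ i j → S i j ⇔ R (tree Q) _ _) (sym (same-rank x)) (sym (same-rank y))
                               (⇔.sym (R⇔S _ _ _)))
  where
    same-rank : ∀ x → rank (tree P) (pebbles P x) ≡ rank (tree Q) (pebbles Q x)
    same-rank x = cong proj₁ (same-keys P≈Q x)

fo-transfer : ∀ {g m n r} (φ : FO g m n) → qr φ ≤ r →
              ∀ {P Q : Pointed g m n} → P ≈[ r ] Q → P ⊨ᶠ φ ⇔ Q ⊨ᶠ φ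
fo-transfer (x ≐ y)    _ P≈Q = same-equalities P≈Q x y
fo-transfer (x ∼ y)    _ P≈Q = via-ranks (λ t u v → datum t u ≡ datum t v) _≡_ ≡⇔rank≡ P≈Q x y
fo-transfer (x ≺ y)    _ P≈Q = via-ranks (λ t u v → datum t u < datum t v) _<_ <⇔rank< P≈Q x y
fo-transfer (x ≺suc y) _ P≈Q = via-ranks SuccData (λ i j → suc i ≡ j) SuccData⇔rank-suc P≈Q x y
fo-transfer (lab a x)  _ P≈Q = mk⇔ (trans (sym same-label)) (trans same-label)
  where same-label = cong (proj₁ ∘ proj₂) (same-keys P≈Q x)
fo-transfer (x ∈ₛ X) _ {P} {Q} P≈Q =
  ⇔.trans (∈⇔colour (tree P) (sets P) (pebbles P x) X)
    (subst (λ col → Vec.lookup col X ≡ true ⇔ pebbles Q x ∈ˢ sets Q X) (sym same-colour)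
      (⇔.sym (∈⇔colour (tree Q) (sets Q) (pebbles Q x) X)))
  where same-colour = cong (proj₂ ∘ proj₂) (same-keys P≈Q x)
fo-transfer (¬ᶠ φ)   qr≤r P≈Q = →-cong-⇔ (fo-transfer φ qr≤r P≈Q) ⇔.refl
fo-transfer (φ ∧ᶠ ψ) qr≤r P≈Q = fo-transfer φ (m⊔n≤o⇒m≤o (qr φ) (qr ψ) qr≤r) P≈Q
                            ×-⇔ fo-transfer ψ (m⊔n≤o⇒n≤o (qr φ) (qr ψ) qr≤r) P≈Q
fo-transfer (φ ∨ᶠ ψ) qr≤r P≈Q = fo-transfer φ (m⊔n≤o⇒m≤o (qr φ) (qr ψ) qr≤r) P≈Q
                            ⊎-⇔ fo-transfer ψ (m⊔n≤o⇒n≤o (qr φ) (qr ψ) qr≤r) P≈Q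
fo-transfer (∃ᶠ φ) (s≤s qr≤r) P≈Q = Σ-⇔-back-and-forth
  (map₂ (fo-transfer φ qr≤r) ∘ forth P≈Q) (map₂ (fo-transfer φ qr≤r) ∘ back P≈Q)
fo-transfer (∀ᶠ φ) (s≤s qr≤r) P≈Q = Π-⇔-back-and-forth
  (map₂ (fo-transfer φ qr≤r) ∘ forth P≈Q) (map₂ (fo-transfer φ qr≤r) ∘ back P≈Q)

-- Set quantifiers

does-≟-Bool : ∀ x b → does (x Bool.≟ b) ≡ (if b then x else not x)
does-≟-Bool false false = refl
does-≟-Bool false true  = refl
does-≟-Bool true  false = refl
does-≟-Bool true  true  = refl

key-∷-⇔ : ∀ {g m} {r i : ℕ} {l a : Fin g} {x b : Bool} {w v : Vec Bool m} →
          (r , l , x ∷ w) ≡ (i , a , b ∷ v) ⇔ ((r , l , w) ≡ (i , a , v) × x ≡ b)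
key-∷-⇔ = mk⇔ (λ { refl → refl , refl }) (λ { (refl , refl) → refl })

classSize-∷ : ∀ {g m} (t : Tree g) (ρ : Assignment t m) X i a b v →
              classSize t (X ∷ᶠ ρ) (i , a , b ∷ v) ≡ cardOn (inClass t ρ (i , a , v)) X b
classSize-∷ t ρ X i a b v = card-cong λ u →
  trans (does-⇔ key-∷-⇔ (key t (X ∷ᶠ ρ) u ≟ᴷ _) ((key t ρ u ≟ᴷ _) ×-dec (Vec.lookup X u Bool.≟ b)))
        (cong (inClass t ρ (i , a , v) u ∧_) (does-≟-Bool (Vec.lookup X u) b))

record ClassSizesAgree {g m} (K : ℕ) (t₁ : Tree g) (ρ₁ : Assignment t₁ m)
                              (t₂ : Tree g) (ρ₂ : Assignment t₂ m) : Set where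
  constructor classSizesAgree
  field same-classSizes : ∀ c → classSize t₁ ρ₁ c ≡[ K ] classSize t₂ ρ₂ c

open ClassSizesAgree

ClassSizesAgree-sym : ∀ {g m K} {t₁ t₂ : Tree g} {ρ₁ : Assignment t₁ m} {ρ₂ : Assignment t₂ m} →
                      ClassSizesAgree K t₁ ρ₁ t₂ ρ₂ → ClassSizesAgree K t₂ ρ₂ t₁ ρ₁
ClassSizesAgree-sym agree = classSizesAgree (sym ∘ same-classSizes agree)

refine : ∀ {g m h} {t₁ t₂ : Tree g} {ρ₁ : Assignment t₁ m} {ρ₂ : Assignment t₂ m} →
         ClassSizesAgree (h + h) t₁ ρ₁ t₂ ρ₂ →
         ∀ X → ∃ λ Y → ClassSizesAgree h t₁ (X ∷ᶠ ρ₁) t₂ (Y ∷ᶠ ρ₂)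
refine {g} {m} {h} {t₁} {t₂} {ρ₁} {ρ₂} agree X = Y , classSizesAgree agree′
  where
    parts : ∀ c → ∃₂ λ y z → y + z ≡ classSize t₂ ρ₂ c ×
                             cardOn (inClass t₁ ρ₁ c) X true ≡[ h ] y ×
                             cardOn (inClass t₁ ρ₁ c) X false ≡[ h ] z
    parts c = ≡[]-split (subst (_≡[ h + h ] classSize t₂ ρ₂ c) (card-split (inClass t₁ ρ₁ c) (Vec.lookup X))
                               (same-classSizes agree c))
    target : Key g m → Bool → ℕ
    target c true  = proj₁ (parts c)
    target c false = proj₁ (proj₂ (parts c))
    near-target : ∀ c b → cardOn (inClass t₁ ρ₁ c) X b ≡[ h ] target c b
    near-target c true  = proj₁ (proj₂ (proj₂ (proj₂ (parts c))))
    near-target c false = proj₂ (proj₂ (proj₂ (proj₂ (parts c))))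
    selected = select-in-classes _≟ᴷ_ (key t₂ ρ₂) target (proj₁ ∘ proj₂ ∘ proj₂ ∘ parts)
    Y = proj₁ selected
    agree′ : ∀ c → classSize t₁ (X ∷ᶠ ρ₁) c ≡[ h ] classSize t₂ (Y ∷ᶠ ρ₂) c
    agree′ (i , a , b ∷ v) = begin
      classSize t₁ (X ∷ᶠ ρ₁) (i , a , b ∷ v) ⊓ h  ≡⟨ cong (_⊓ h) (classSize-∷ t₁ ρ₁ X i a b v) ⟩
      cardOn (inClass t₁ ρ₁ c) X b ⊓ h           ≡⟨ near-target c b ⟩
      target c b ⊓ h                             ≡⟨ cong (_⊓ h) (sym (proj₂ selected c b)) ⟩
      cardOn (inClass t₂ ρ₂ c) Y b ⊓ h           ≡⟨ cong (_⊓ h) (sym (classSize-∷ t₂ ρ₂ Y i a b v)) ⟩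
      classSize t₂ (Y ∷ᶠ ρ₂) (i , a , b ∷ v) ⊓ h  ∎
      where
        c = i , a , v
        open ≡-Reasoning

classSize≡freeSize : ∀ {g m} (t : Tree g) (ρ : Assignment t m) (σ : Vector (Node t) 0) c →
                     classSize t ρ c ≡ freeSize (pointed t ρ σ) c
classSize≡freeSize t ρ σ c = card-cong λ u → sym (Bool.∧-identityʳ (inClass t ρ c u))

≈-unpebbled : ∀ {g m r} {t₁ t₂ : Tree g} {ρ₁ : Assignment t₁ m} {ρ₂ : Assignment t₂ m}
                {σ₁ : Vector (Node t₁) 0} {σ₂ : Vector (Node t₂) 0} →
              ClassSizesAgree r t₁ ρ₁ t₂ ρ₂ → pointed t₁ ρ₁ σ₁ ≈[ r ] pointed t₂ ρ₂ σ₂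
≈-unpebbled {t₁ = t₁} {t₂} {ρ₁} {ρ₂} {σ₁} {σ₂} agree = record
  { same-equalities = λ ()
  ; same-keys       = λ ()
  ; same-freeSizes  = λ c → subst₂ _≡[ _ ]_ (classSize≡freeSize t₁ ρ₁ σ₁ c)
                                            (classSize≡freeSize t₂ ρ₂ σ₂ c)
                                            (same-classSizes agree c)
  }

k*2^s≤ : ∀ k s → k ≤ k * 2 ^ s
k*2^s≤ k s = subst (_≤ k * 2 ^ s) (*-identityʳ k) (*-monoʳ-≤ k (m^n>0 2 s))

k*2^[1+s] : ∀ k s → k * 2 ^ suc s ≡ k * 2 ^ s + k * 2 ^ s
k*2^[1+s] k s = trans (*-distribˡ-+ k (2 ^ s) (2 ^ s + 0)) (cong (λ n → k * 2 ^ s + k * n) (+-identityʳ (2 ^ s)))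

mso-transfer : ∀ {g m k} (φ : MSO g m) s → msoQr φ ≤ s → foQr φ ≤ k →
               ∀ {t₁ t₂ : Tree g} {ρ₁ : Assignment t₁ m} {ρ₂ : Assignment t₂ m} →
               ClassSizesAgree (k * 2 ^ s) t₁ ρ₁ t₂ ρ₂ → SatM t₁ ρ₁ φ ⇔ SatM t₂ ρ₂ φ

mso-transfer-∷ : ∀ {g m k} (φ : MSO g (suc m)) s → msoQr φ ≤ s → foQr φ ≤ k →
                 ∀ {t₁ t₂ : Tree g} {ρ₁ : Assignment t₁ m} {ρ₂ : Assignment t₂ m} →
                 ClassSizesAgree (k * 2 ^ suc s) t₁ ρ₁ t₂ ρ₂ →
                 ∀ X → ∃ λ Y → SatM t₁ (X ∷ᶠ ρ₁) φ ⇔ SatM t₂ (Y ∷ᶠ ρ₂) φ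
mso-transfer-∷ {k = k} φ s msoQr≤s qr≤k {t₁} {t₂} {ρ₁} {ρ₂} agree X =
  map₂ (mso-transfer φ s msoQr≤s qr≤k)
    (refine (subst (λ K → ClassSizesAgree K t₁ ρ₁ t₂ ρ₂) (k*2^[1+s] k s) agree) X)

mso-transfer {k = k} (fo ψ) s _ qr≤k agree =
  fo-transfer ψ qr≤k (≈-unpebbled (classSizesAgree (≡[]-weaken (k*2^s≤ k s) ∘ same-classSizes agree)))
mso-transfer (∃ˢ φ) (suc s) (s≤s msoQr≤s) qr≤k agree = Σ-⇔-back-and-forth
  (mso-transfer-∷ φ s msoQr≤s qr≤k agree)
  (map₂ ⇔.sym ∘ mso-transfer-∷ φ s msoQr≤s qr≤k (ClassSizesAgree-sym agree))
mso-transfer (∀ˢ φ) (suc s) (s≤s msoQr≤s) qr≤k agree = Π-⇔-back-and-forth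
  (mso-transfer-∷ φ s msoQr≤s qr≤k agree)
  (map₂ ⇔.sym ∘ mso-transfer-∷ φ s msoQr≤s qr≤k (ClassSizesAgree-sym agree))

-- The extended representation

module _ {g} (t : Tree g) (ρ : Assignment t 0) (i : ℕ) (a : Fin g) where

  classSize-beyond : sortedData t ‼ i ≡ nothing → classSize t ρ (i , a , []) ≡ 0
  classSize-beyond D‼i≡nothing = card-empty λ u → dec-false (key t ρ u ≟ᴷ _) λ key≡ →
    case trans (sym D‼i≡nothing)
               (subst (λ j → sortedData t ‼ j ≡ just (datum t u)) (cong proj₁ key≡) (sortedData-‼-rank t u))
    of λ ()

  -- The class of (i, a) consists of the a-nodes with value dᵢ; capped at K, its size is fᵢ(a).
  classSize-count : ∀ {d} → sortedData t ‼ i ≡ just d → classSize t ρ (i , a , []) ≡ count t a d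
  classSize-count {d} D‼i≡d =
    trans (card-cong λ u → does-⇔ (class⇔ u) (key t ρ u ≟ᴷ _) ((label t u Fin.≟ a) ×-dec (datum t u ≟ d)))
          (sym (card-filter _ (nodes t)))
    where
      rank⇔ : ∀ u → rank t u ≡ i ⇔ datum t u ≡ d
      rank⇔ u = Increasing.‼-≡-⇔ (sortedData-increasing t) (sortedData-‼-rank t u) D‼i≡d
      class⇔ : ∀ u → key t ρ u ≡ (i , a , []) ⇔ (label t u ≡ a × datum t u ≡ d)
      class⇔ u = mk⇔ (λ key≡ → cong (proj₁ ∘ proj₂) key≡ , Equivalence.to (rank⇔ u) (cong proj₁ key≡))
                     (λ (label≡ , datum≡) →
                        cong₂ (λ r l → r , l , []) (Equivalence.from (rank⇔ u) datum≡) label≡)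

classSizes-from-extRep : ∀ {g K} {t₁ t₂ : Tree g} → extRep K t₁ ≡ extRep K t₂ →
                         ∀ {ρ₁ : Assignment t₁ 0} {ρ₂ : Assignment t₂ 0} →
                         ClassSizesAgree K t₁ ρ₁ t₂ ρ₂
classSizes-from-extRep {K = K} {t₁} {t₂} same {ρ₁} {ρ₂} = classSizesAgree agree
  where
    entry : ∀ {g} → Tree g → ℕ → Subset g × Vec ℕ g
    entry t d = labelSet t d , charFun K t d
    same-entry : ∀ i → Maybe.map (entry t₁) (sortedData t₁ ‼ i) ≡ Maybe.map (entry t₂) (sortedData t₂ ‼ i)
    same-entry i = trans (sym (‼-map (entry t₁) (sortedData t₁) i))
                         (trans (cong (_‼ i) same) (‼-map (entry t₂) (sortedData t₂) i))
    agree : ∀ c → classSize t₁ ρ₁ c ≡[ K ] classSize t₂ ρ₂ c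
    agree (i , a , []) with sortedData t₁ ‼ i in D₁‼i | sortedData t₂ ‼ i in D₂‼i | same-entry i
    ... | just d₁ | just d₂ | same-entryᵢ = begin
      classSize t₁ ρ₁ (i , a , []) ⊓ K  ≡⟨ cong (_⊓ K) (classSize-count t₁ ρ₁ i a D₁‼i) ⟩
      count t₁ a d₁ ⊓ K                ≡⟨ sym (Vec.lookup∘tabulate (λ b → count t₁ b d₁ ⊓ K) a) ⟩
      Vec.lookup (charFun K t₁ d₁) a   ≡⟨ cong (λ f → Vec.lookup f a) (cong proj₂ (just-injective same-entryᵢ)) ⟩
      Vec.lookup (charFun K t₂ d₂) a   ≡⟨ Vec.lookup∘tabulate (λ b → count t₂ b d₂ ⊓ K) a ⟩
      count t₂ a d₂ ⊓ K                ≡⟨ cong (_⊓ K) (sym (classSize-count t₂ ρ₂ i a D₂‼i)) ⟩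
      classSize t₂ ρ₂ (i , a , []) ⊓ K  ∎
      where open ≡-Reasoning
    ... | nothing | nothing | _ =
      cong (_⊓ K) (trans (classSize-beyond t₁ ρ₁ i a D₁‼i) (sym (classSize-beyond t₂ ρ₂ i a D₂‼i)))

corollary4p3 : ∀ {g : ℕ} (k s : ℕ) (t₁ t₂ : Tree g) →
                 extRep (k * 2 ^ s) t₁ ≡ extRep (k * 2 ^ s) t₂ →
                 (φ : Sentence g) → msoQr φ ≤ s → foQr φ ≤ k →
                 (t₁ ⊨ φ) ⇔ (t₂ ⊨ φ)
corollary4p3 k s t₁ t₂ same φ msoQr≤s foQr≤k = mso-transfer φ s msoQr≤s foQr≤k (classSizes-from-extRep same)
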